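{- Let $X\subseteq\mathbb{N}$, let $n\ge1$ and $s\ge0$ be integers. Then $$P_{n,s}^{X}=|X_n^c|!\sum_{r=0}^{|X_n|-s}(-1)^{|X_n|-s-r}\binom{|X_n^c|+r}{r}\binom{n+1}{|X_n|-s-r}\prod_{x\in X_n}\bigl(r+\beta_{X,n,x}\bigr).$$
   Context: $\mathbb{N}=\{1,2,\dots\}$, $S_n$ is the set of permutations $\sigma=\sigma_1\cdots\sigma_n$ of $[n]$. For $X\subseteq\mathbb{N}$, $P_{n,s}^X$ is the number of $\sigma\in S_n$ having exactly $s$ indices $i$ with $\sigma_i>\sigma_{i+1}$ and $\sigma_i\in X$. $X_n=X\cap[n]$, $X_n^c=[n]\setminus X$, and for $1\le j\le n$, $\beta_{X,n,j}=|\{z:1\le z<j,\ z\notin X\}|$. An empty sum is $0$. -}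

module Defs where

open import Data.Bool using (Bool; true; false; _∧_; if_then_else_; not)
open import Data.Nat using (ℕ; zero; suc; _+_; _*_; _∸_; _<ᵇ_; _≡ᵇ_)
open import Data.Nat.Combinatorics using (_C_)
open import Data.Integer using (ℤ; +_; -_; -[1+_]) renaming (_*_ to _*ℤ_; _^_ to _^ℤ_)
open import Data.List using (List; []; _∷_; map; concatMap; filterᵇ; length; applyUpTo; upTo; foldr)
open import Data.Bool.ListAction using (any)
open import Data.Nat.ListAction using (product)

-- A subset X ⊆ ℕ = {1,2,...} is given by its characteristic function X : ℕ → Bool
-- (X z ≡ true  iff  z ∈ X).  The value X 0 is irrelevant (never consulted).
Subset : Set
Subset = ℕ → Bool

range : ℕ → List ℕ
range n = applyUpTo suc n

words : ℕ → ℕ → List (List ℕ)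
words zero    n = [] ∷ []
words (suc k) n = concatMap (λ a → map (a ∷_) (words k n)) (range n)

noDup : List ℕ → Bool
noDup []       = true
noDup (a ∷ as) = not (any (λ b → a ≡ᵇ b) as) ∧ noDup as

-- S_n : all permutations σ = σ₁⋯σₙ of [n], i.e. words of length n over [n]
-- with pairwise distinct letters (one-line notation)
perms : ℕ → List (List ℕ)
perms n = filterᵇ noDup (words n n)

desX : Subset → List ℕ → ℕ
desX X []            = 0
desX X (a ∷ [])      = 0
desX X (a ∷ b ∷ rest) = (if (b <ᵇ a) ∧ X a then 1 else 0) + desX X (b ∷ rest)

P : Subset → ℕ → ℕ → ℕ
P X n s = length (filterᵇ (λ σ → desX X σ ≡ᵇ s) (perms n))

Xn : Subset → ℕ → List ℕ
Xn X n = filterᵇ X (range n)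

Xnc : Subset → ℕ → List ℕ
Xnc X n = filterᵇ (λ z → not (X z)) (range n)

-- β_{X,n,j} = |{z : 1 ≤ z < j, z ∉ X}|  (independent of n for j ≤ n)
β : Subset → ℕ → ℕ → ℕ
β X n j = length (filterᵇ (λ z → not (X z)) (range (j ∸ 1)))

sumℤ : List ℤ → ℤ
sumℤ = foldr Data.Integer._+_ (+ 0)

RHS : Subset → ℕ → ℕ → ℤ
RHS X n s =
  let m = length (Xn X n)
      c = length (Xnc X n)
  in (+ (c Data.Nat.!)) *ℤ
     sumℤ (map (λ r →
        ((- (+ 1)) ^ℤ (m ∸ s ∸ r)) *ℤ
        + (((c + r) C r) * ((suc n) C (m ∸ s ∸ r))
           * product (map (λ x → r + β X n x) (Xn X n))))
       -- r ranges over 0,…,m-s ; empty when s > m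
       (upTo (suc m ∸ s)))

module Submission where

-- Inserting the maximum n + 1 into the permutations of [n] shows that, whether or not n + 1 ∈ X,
--   P_{n+1,s} = (n + 1 − s) q_s + (s + 1) q_{s+1},   q_s = P_{n, s − [n+1 ∈ X]}.
-- Read backwards, f_n(k) = P_{n,|X_n|−k}, this becomes
--   f_{n+1}(k) = (k + c) ∇f_n(k) + (n + 2) f_n(k − 1),   c = |X_{n+1}^c|,
-- with ∇ the backward difference and f(−1) = 0. The weights
--   w_n(r) = |X_n^c|! C(|X_n^c| + r, r) ∏_{x ∈ X_n} (r + β_x)
-- satisfy w_{n+1}(r) = (r + c) w_n(r), so by the Leibniz rule for ∇ the sequences ∇^{n+1} w_n obey the
-- same recurrence; for n = 0 both sides are [k = 0]. Expanding ∇^{n+1} binomially gives the formula.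

open import Data.Nat using (ℕ)
open import Relation.Binary.PropositionalEquality using (_≡_)
open import Defs

module Lists where

  open import Data.Bool using (Bool; true; false; if_then_else_)
  open import Data.Empty using (⊥-elim)
  open import Data.List using (List; []; _∷_; _++_; concatMap; length; filterᵇ; map)
  open import Data.List.Properties using (length-++; length-++-sucʳ; filter-++)
  open import Data.List.Relation.Unary.All as All using (All; []; _∷_)
  open import Data.List.Relation.Unary.Any using (here; there)
  open import Data.List.Relation.Unary.Unique.Propositional using (Unique; []; _∷_)
  import Data.List.Relation.Unary.Unique.Propositional.Properties as Unique
  open import Data.List.Relation.Binary.Subset.Propositional using (_⊆_)
  open import Data.List.Membership.Propositional using (_∈_; find)
  open import Data.List.Membership.Propositional.Properties
    using (∈-++⁻; ∈-++⁺ˡ; ∈-++⁺ʳ; ∈-∃++; ∈-concatMap⁻)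
  open import Data.List.Membership.Propositional.Properties.WithK using (unique∧set⇒bag)
  open import Data.List.Relation.Binary.BagAndSetEquality using (∼bag⇒↭)
  open import Data.List.Relation.Binary.Permutation.Propositional using (_↭_; ↭⇒↭ₛ)
  import Data.List.Relation.Binary.Permutation.Setoid.Properties as Permutationₛ
  open import Data.Nat using (suc; _+_; _*_; _≤_; z≤n; s≤s)
  open import Data.Nat.ListAction using (sum)
  open import Data.Nat.Properties using (*-zeroʳ)
  open import Data.Nat.Tactic.RingSolver using (solve-∀)
  open import Data.Product using (_×_; _,_)
  open import Data.Sum using (inj₁; inj₂)
  open import Function using (_∘_; _⇔_)
  open import Relation.Binary.PropositionalEquality
    using (_≢_; refl; sym; cong; cong₂; subst; setoid; module ≡-Reasoning)
  open import Relation.Nullary using (¬_)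
  open import Relation.Nullary.Decidable using (T?)

  ind : Bool → ℕ
  ind b = if b then 1 else 0

  module _ {A : Set} where

    Unique-⊆⇒length≤ : ∀ {xs ys : List A} → Unique xs → xs ⊆ ys → length xs ≤ length ys
    Unique-⊆⇒length≤ {[]} _ _ = z≤n
    Unique-⊆⇒length≤ {x ∷ xs} {ys} (x∉xs ∷ u) xs⊆ys with ∈-∃++ (xs⊆ys (here refl))
    ... | as , bs , refl = subst (suc (length xs) ≤_) (sym (length-++-sucʳ as x bs))
          (s≤s (Unique-⊆⇒length≤ u λ z∈xs →
                 delete-∈ (xs⊆ys (there z∈xs)) (All.lookup x∉xs z∈xs ∘ sym)))
      where
      delete-∈ : ∀ {z} → z ∈ as ++ x ∷ bs → z ≢ x → z ∈ as ++ bs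
      delete-∈ z∈ z≢x with ∈-++⁻ as z∈
      ... | inj₁ z∈as = ∈-++⁺ˡ z∈as
      ... | inj₂ (here z≡x) = ⊥-elim (z≢x z≡x)
      ... | inj₂ (there z∈bs) = ∈-++⁺ʳ as z∈bs

    Unique-resp-↭ : ∀ {xs ys : List A} → xs ↭ ys → Unique xs → Unique ys
    Unique-resp-↭ p = Permutationₛ.Unique-resp-↭ (setoid A) (↭⇒↭ₛ p)

    unique∧set⇒↭ : ∀ {xs ys : List A} → Unique xs → Unique ys →
                   (∀ {z} → z ∈ xs ⇔ z ∈ ys) → xs ↭ ys
    unique∧set⇒↭ u v eq = ∼bag⇒↭ (unique∧set⇒bag u v eq)

    Unique-concatMap⁺ : ∀ {B : Set} (f : B → List A) {xs} → Unique xs →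
      (∀ {x} → x ∈ xs → Unique (f x)) →
      (∀ {x y z} → x ∈ xs → y ∈ xs → z ∈ f x → z ∈ f y → x ≡ y) →
      Unique (concatMap f xs)
    Unique-concatMap⁺ f {[]} _ _ _ = []
    Unique-concatMap⁺ f {x ∷ xs} (x∉xs ∷ u) uf sep =
      Unique.++⁺ (uf (here refl)) (Unique-concatMap⁺ f u (uf ∘ there) λ p q → sep (there p) (there q))
                 disjoint
      where
      disjoint : ∀ {z} → ¬ (z ∈ f x × z ∈ concatMap f xs)
      disjoint (z∈fx , z∈rest) with find (∈-concatMap⁻ f z∈rest)
      ... | y , y∈xs , z∈fy = All.lookup x∉xs y∈xs (sep (here refl) (there y∈xs) z∈fx z∈fy)

    length-filterᵇ : ∀ (p : A → Bool) xs → length (filterᵇ p xs) ≡ sum (map (ind ∘ p) xs)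
    length-filterᵇ p [] = refl
    length-filterᵇ p (x ∷ xs) with p x
    ... | true = cong suc (length-filterᵇ p xs)
    ... | false = length-filterᵇ p xs

    length-filterᵇ-concatMap : ∀ {B : Set} (p : B → Bool) (f : A → List B) xs →
      length (filterᵇ p (concatMap f xs)) ≡ sum (map (λ x → length (filterᵇ p (f x))) xs)
    length-filterᵇ-concatMap p f [] = refl
    length-filterᵇ-concatMap p f (x ∷ xs) = begin
      length (filterᵇ p (f x ++ concatMap f xs))
        ≡⟨ cong length (filter-++ (T? ∘ p) (f x) _) ⟩
      length (filterᵇ p (f x) ++ filterᵇ p (concatMap f xs))
        ≡⟨ length-++ (filterᵇ p (f x)) ⟩
      length (filterᵇ p (f x)) + length (filterᵇ p (concatMap f xs))
        ≡⟨ cong (length (filterᵇ p (f x)) +_) (length-filterᵇ-concatMap p f xs) ⟩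
      sum (map (λ x → length (filterᵇ p (f x))) (x ∷ xs)) ∎
      where open ≡-Reasoning

    sum-map-linear : ∀ a b (f g : A → ℕ) xs →
      sum (map (λ x → a * f x + b * g x) xs) ≡ a * sum (map f xs) + b * sum (map g xs)
    sum-map-linear a b f g [] = sym (cong₂ _+_ (*-zeroʳ a) (*-zeroʳ b))
    sum-map-linear a b f g (x ∷ xs) rewrite sum-map-linear a b f g xs =
      regroup a b (f x) (g x) (sum (map f xs)) (sum (map g xs))
      where
      regroup : ∀ a b u v U V → (a * u + b * v) + (a * U + b * V) ≡ a * (u + U) + b * (v + V)
      regroup = solve-∀

module Permutations where

  open import Data.Bool using (Bool; true; false; T; not; if_then_else_)
  open import Data.Bool.Properties using (T-∧)
  open import Data.Empty using (⊥-elim)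
  open import Data.List
    using (List; []; _∷_; [_]; _++_; map; concatMap; cartesianProductWith; length; filterᵇ)
  open import Data.List.Properties
    using (length-++; length-applyUpTo; length-++-sucʳ; applyUpTo-∷ʳ; ∷-injective; ∷-injectiveʳ; filter-++)
  open import Data.List.Relation.Unary.All as All using (All; []; _∷_)
  open import Data.List.Relation.Unary.All.Properties using (¬Any⇒All¬; All¬⇒¬Any)
  open import Data.List.Relation.Unary.Any as Any using (here; there)
  open import Data.List.Relation.Unary.Any.Properties using (any⁺; any⁻)
  open import Data.List.Relation.Unary.Unique.Propositional using (Unique; []; _∷_)
  import Data.List.Relation.Unary.Unique.Propositional.Properties as Unique
  open import Data.List.Relation.Binary.Subset.Propositional using (_⊆_)
  open import Data.List.Membership.Propositional using (_∈_; _∉_; find)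
  open import Data.List.Membership.Propositional.Properties
    using (∈-applyUpTo⁺; ∈-applyUpTo⁻; ∈-∃++; ∈-map⁺; ∈-map⁻; ∈-filter⁺; ∈-filter⁻;
           ∈-cartesianProductWith⁺; ∈-cartesianProductWith⁻; ∈-concatMap⁺; ∈-concatMap⁻)
  open import Data.List.Relation.Binary.Permutation.Propositional
    using (_↭_; ↭-refl; ↭-sym; ↭-trans; ↭-prep; ↭-swap)
  open import Data.List.Relation.Binary.Permutation.Propositional.Properties
    using (↭-length; ∈-resp-↭; shift)
  open import Data.Nat using (zero; suc; _+_; _<_; _≤_; z≤n; s≤s; _≡ᵇ_)
  open import Data.Nat.Properties
    using (_≟_; ≡ᵇ⇒≡; ≡⇒≡ᵇ; <-irrefl; ≤-refl; ≤-pred; m≤n⇒m≤1+n; suc-injective; <⇒≢;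
           m≤n⇒m<n∨m≡n)
  open import Data.List.Membership.DecPropositional _≟_ using (_∈?_)
  open import Data.Product using (_×_; _,_; proj₁; proj₂; ∃)
  open import Data.Sum using (inj₁; inj₂)
  open import Function using (_∘_; mk⇔; Equivalence)
  open import Relation.Binary.PropositionalEquality using (_≢_; refl; sym; trans; cong; subst₂)
  open import Relation.Nullary using (¬_; yes; no)
  open import Relation.Nullary.Decidable using (T?)
  open Lists

  range-suc : ∀ n → range (suc n) ≡ range n ++ [ suc n ]
  range-suc n = sym (applyUpTo-∷ʳ suc n)

  filterᵇ-range-suc : ∀ (p : ℕ → Bool) n →
    filterᵇ p (range (suc n)) ≡ filterᵇ p (range n) ++ (if p (suc n) then [ suc n ] else [])
  filterᵇ-range-suc p n = trans (cong (filterᵇ p) (range-suc n))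
    (trans (filter-++ (T? ∘ p) (range n) [ suc n ]) (cong (filterᵇ p (range n) ++_) last))
    where
    last : filterᵇ p [ suc n ] ≡ (if p (suc n) then [ suc n ] else [])
    last with p (suc n)
    ... | true = refl
    ... | false = refl

  length-filterᵇ-range-suc : ∀ (p : ℕ → Bool) n →
    length (filterᵇ p (range (suc n))) ≡ length (filterᵇ p (range n)) + ind (p (suc n))
  length-filterᵇ-range-suc p n
    rewrite filterᵇ-range-suc p n | length-++ (filterᵇ p (range n)) {if p (suc n) then [ suc n ] else []}
    with p (suc n)
  ... | true = refl
  ... | false = refl

  ∈-range⁺ : ∀ {n x} → 1 ≤ x → x ≤ n → x ∈ range n
  ∈-range⁺ {x = suc x} _ x<n = ∈-applyUpTo⁺ suc x<n

  ∈-range⁻ : ∀ {n x} → x ∈ range n → 1 ≤ x × x ≤ n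
  ∈-range⁻ x∈ with ∈-applyUpTo⁻ suc x∈
  ... | i , i<n , refl = s≤s z≤n , i<n

  ∈-range-suc⁻ : ∀ {n x} → x ∈ range (suc n) → x ≢ suc n → x ∈ range n
  ∈-range-suc⁻ x∈ x≢n+1 with ∈-range⁻ x∈
  ... | 1≤x , x≤n+1 with m≤n⇒m<n∨m≡n x≤n+1
  ...   | inj₁ x<n+1 = ∈-range⁺ 1≤x (≤-pred x<n+1)
  ...   | inj₂ x≡n+1 = ⊥-elim (x≢n+1 x≡n+1)

  Unique-range : ∀ n → Unique (range n)
  Unique-range n = Unique.applyUpTo⁺₁ suc n (λ i<j _ → <⇒≢ i<j ∘ suc-injective)

  private
    T-not⇒¬T : ∀ {b} → T (not b) → ¬ T b
    T-not⇒¬T {true} ()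

    ¬T⇒T-not : ∀ {b} → ¬ T b → T (not b)
    ¬T⇒T-not {true} ¬t = ¬t _
    ¬T⇒T-not {false} _ = _

  noDup⇒Unique : ∀ σ → T (noDup σ) → Unique σ
  noDup⇒Unique [] _ = []
  noDup⇒Unique (a ∷ σ) t with Equivalence.to T-∧ t
  ... | fresh , rest =
    ¬Any⇒All¬ σ (T-not⇒¬T fresh ∘ any⁺ _ ∘ Any.map (≡⇒≡ᵇ a _)) ∷ noDup⇒Unique σ rest

  Unique⇒noDup : ∀ σ → Unique σ → T (noDup σ)
  Unique⇒noDup [] _ = _
  Unique⇒noDup (a ∷ σ) (a∉σ ∷ u) =
    Equivalence.from T-∧
      (¬T⇒T-not (All¬⇒¬Any a∉σ ∘ Any.map (≡ᵇ⇒≡ a _) ∘ any⁻ _ σ) , Unique⇒noDup σ u)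

  words-suc : ∀ k n → words (suc k) n ≡ cartesianProductWith _∷_ (range n) (words k n)
  words-suc k n = go (range n)
    where
    go : ∀ as →
      concatMap (λ a → map (a ∷_) (words k n)) as ≡ cartesianProductWith _∷_ as (words k n)
    go [] = refl
    go (a ∷ as) = cong (map (a ∷_) (words k n) ++_) (go as)

  ∈-words⁺ : ∀ k n σ → length σ ≡ k → σ ⊆ range n → σ ∈ words k n
  ∈-words⁺ zero n [] _ _ = here refl
  ∈-words⁺ (suc k) n (a ∷ τ) len σ⊆ rewrite words-suc k n =
    ∈-cartesianProductWith⁺ _∷_ (σ⊆ (here refl))
      (∈-words⁺ k n τ (suc-injective len) (σ⊆ ∘ there))

  ∈-words⁻ : ∀ k n σ → σ ∈ words k n → length σ ≡ k × σ ⊆ range n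
  ∈-words⁻ zero n .[] (here refl) = refl , λ ()
  ∈-words⁻ (suc k) n σ σ∈ rewrite words-suc k n
    with ∈-cartesianProductWith⁻ _∷_ (range n) (words k n) σ∈
  ... | a , τ , a∈ , τ∈ , refl with ∈-words⁻ k n τ τ∈
  ... | len , τ⊆ = cong suc len , λ { (here refl) → a∈ ; (there z∈) → τ⊆ z∈ }

  Unique-words : ∀ k n → Unique (words k n)
  Unique-words zero n = [] ∷ []
  Unique-words (suc k) n rewrite words-suc k n =
    Unique.cartesianProductWith⁺ _∷_ ∷-injective (Unique-range n) (Unique-words k n)

  IsPerm : ℕ → List ℕ → Set
  IsPerm n σ = length σ ≡ n × σ ⊆ range n × Unique σ

  ∈-perms⁺ : ∀ {n σ} → IsPerm n σ → σ ∈ perms n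
  ∈-perms⁺ {n} {σ} (len , σ⊆ , u) =
    ∈-filter⁺ (T? ∘ noDup) (∈-words⁺ n n σ len σ⊆) (Unique⇒noDup σ u)

  ∈-perms⁻ : ∀ {n σ} → σ ∈ perms n → IsPerm n σ
  ∈-perms⁻ {n} {σ} σ∈ with ∈-filter⁻ (T? ∘ noDup) {xs = words n n} σ∈
  ... | σ∈words , nd with ∈-words⁻ n n σ σ∈words
  ... | len , σ⊆ = len , σ⊆ , noDup⇒Unique σ nd

  Unique-perms : ∀ n → Unique (perms n)
  Unique-perms n = Unique.filter⁺ (T? ∘ noDup) (Unique-words n n)

  ∈-perms⇒bounded : ∀ {n σ} → σ ∈ perms n → length σ ≡ n × All (_< suc n) σ
  ∈-perms⇒bounded σ∈ with ∈-perms⁻ σ∈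
  ... | len , σ⊆ , _ = len , All.tabulate (λ z∈ → s≤s (proj₂ (∈-range⁻ (σ⊆ z∈))))

  max∉perm : ∀ {n σ} → σ ⊆ range n → suc n ∉ σ
  max∉perm σ⊆ n+1∈σ = <-irrefl refl (proj₂ (∈-range⁻ (σ⊆ n+1∈σ)))

  max∈perm : ∀ {n σ} → IsPerm (suc n) σ → suc n ∈ σ
  max∈perm {n} {σ} (len , σ⊆ , u) with suc n ∈? σ
  ... | yes n+1∈σ = n+1∈σ
  ... | no n+1∉σ =
    ⊥-elim (<-irrefl refl (subst₂ _≤_ len (length-applyUpTo suc n) (Unique-⊆⇒length≤ u σ⊆range)))
    where
    σ⊆range : σ ⊆ range n
    σ⊆range z∈ = ∈-range-suc⁻ (σ⊆ z∈) λ { refl → n+1∉σ z∈ }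

  insertions : ℕ → List ℕ → List (List ℕ)
  insertions v [] = [ [ v ] ]
  insertions v (a ∷ σ) = (v ∷ a ∷ σ) ∷ map (a ∷_) (insertions v σ)

  ∈-insertions⇒↭ : ∀ v σ {w} → w ∈ insertions v σ → w ↭ v ∷ σ
  ∈-insertions⇒↭ v [] (here refl) = ↭-refl
  ∈-insertions⇒↭ v (a ∷ σ) (here refl) = ↭-refl
  ∈-insertions⇒↭ v (a ∷ σ) (there w∈) with ∈-map⁻ (a ∷_) w∈
  ... | w , w∈′ , refl = ↭-trans (↭-prep a (∈-insertions⇒↭ v σ w∈′)) (↭-swap a v ↭-refl)

  ∈-insertions⁺ : ∀ v as bs → as ++ v ∷ bs ∈ insertions v (as ++ bs)
  ∈-insertions⁺ v [] [] = here refl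
  ∈-insertions⁺ v [] (b ∷ bs) = here refl
  ∈-insertions⁺ v (a ∷ as) bs = there (∈-map⁺ (a ∷_) (∈-insertions⁺ v as bs))

  Unique-insertions : ∀ v σ → v ∉ σ → Unique (insertions v σ)
  Unique-insertions v [] _ = [] ∷ []
  Unique-insertions v (a ∷ σ) v∉ =
    All.tabulate head-fresh ∷ Unique.map⁺ ∷-injectiveʳ (Unique-insertions v σ (v∉ ∘ there))
    where
    head-fresh : ∀ {w} → w ∈ map (a ∷_) (insertions v σ) → v ∷ a ∷ σ ≢ w
    head-fresh w∈ eq with ∈-map⁻ (a ∷_) w∈
    ... | _ , _ , refl = v∉ (here (proj₁ (∷-injective eq)))

  erase : ℕ → List ℕ → List ℕ
  erase v [] = []
  erase v (x ∷ w) = if x ≡ᵇ v then w else x ∷ erase v w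

  erase-head : ∀ v w → erase v (v ∷ w) ≡ w
  erase-head v w with v ≡ᵇ v | ≡⇒≡ᵇ v v refl
  ... | true | _ = refl

  erase-cons : ∀ {v a w} → a ≢ v → erase v (a ∷ w) ≡ a ∷ erase v w
  erase-cons {v} {a} a≢v with a ≡ᵇ v | ≡ᵇ⇒≡ a v
  ... | false | _ = refl
  ... | true | a≡v = ⊥-elim (a≢v (a≡v _))

  erase-insertions : ∀ v σ {w} → v ∉ σ → w ∈ insertions v σ → erase v w ≡ σ
  erase-insertions v [] _ (here refl) = erase-head v []
  erase-insertions v (a ∷ σ) _ (here refl) = erase-head v (a ∷ σ)
  erase-insertions v (a ∷ σ) v∉ (there w∈) with ∈-map⁻ (a ∷_) w∈
  ... | w , w∈′ , refl = trans (erase-cons (λ a≡v → v∉ (here (sym a≡v))))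
                               (cong (a ∷_) (erase-insertions v σ (v∉ ∘ there) w∈′))

  ∈-insertions⇒IsPerm : ∀ {n σ w} → σ ∈ perms n → w ∈ insertions (suc n) σ → IsPerm (suc n) w
  ∈-insertions⇒IsPerm {n} {σ} {w} σ∈ w∈ with ∈-perms⁻ σ∈
  ... | len , σ⊆ , u = trans (↭-length w↭) (cong suc len) , w⊆ , w-unique
    where
    w↭ = ∈-insertions⇒↭ (suc n) σ w∈
    w-unique : Unique w
    w-unique = Unique-resp-↭ (↭-sym w↭) (¬Any⇒All¬ σ (max∉perm σ⊆) ∷ u)
    w⊆ : w ⊆ range (suc n)
    w⊆ z∈ with ∈-resp-↭ w↭ z∈
    ... | here refl = ∈-range⁺ (s≤s z≤n) ≤-refl
    ... | there z∈σ with ∈-range⁻ (σ⊆ z∈σ)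
    ...   | 1≤z , z≤n′ = ∈-range⁺ 1≤z (m≤n⇒m≤1+n z≤n′)

  IsPerm⇒∈-insertions : ∀ {n w} → IsPerm (suc n) w →
                        ∃ λ σ → σ ∈ perms n × w ∈ insertions (suc n) σ
  IsPerm⇒∈-insertions {n} p@(len , w⊆ , u) with ∈-∃++ (max∈perm p)
  ... | as , bs , refl with Unique-resp-↭ (shift (suc n) as bs) u
  ... | n+1∉σ ∷ uσ = as ++ bs , ∈-perms⁺ (len′ , σ⊆ , uσ) , ∈-insertions⁺ (suc n) as bs
    where
    len′ : length (as ++ bs) ≡ n
    len′ = suc-injective (trans (sym (length-++-sucʳ as (suc n) bs)) len)
    σ⊆ : as ++ bs ⊆ range n
    σ⊆ z∈ = ∈-range-suc⁻ (w⊆ (∈-resp-↭ (↭-sym (shift (suc n) as bs)) (there z∈)))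
                          λ { refl → All¬⇒¬Any n+1∉σ z∈ }

  perms-suc↭ : ∀ n → perms (suc n) ↭ concatMap (insertions (suc n)) (perms n)
  perms-suc↭ n =
    unique∧set⇒↭ (Unique-perms (suc n)) unique-insertions (mk⇔ ⊆-insertions insertions-⊆)
    where
    fresh : ∀ {σ} → σ ∈ perms n → suc n ∉ σ
    fresh σ∈ = max∉perm (proj₁ (proj₂ (∈-perms⁻ σ∈)))
    unique-insertions : Unique (concatMap (insertions (suc n)) (perms n))
    unique-insertions = Unique-concatMap⁺ (insertions (suc n)) (Unique-perms n)
      (λ σ∈ → Unique-insertions (suc n) _ (fresh σ∈))
      (λ {σ} {τ} σ∈ τ∈ w∈σ w∈τ → trans (sym (erase-insertions (suc n) σ (fresh σ∈) w∈σ))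
                                        (erase-insertions (suc n) τ (fresh τ∈) w∈τ))
    ⊆-insertions : perms (suc n) ⊆ concatMap (insertions (suc n)) (perms n)
    ⊆-insertions w∈ with IsPerm⇒∈-insertions (∈-perms⁻ w∈)
    ... | σ , σ∈ , w∈σ = ∈-concatMap⁺ (insertions (suc n)) (Any.map (λ { refl → w∈σ }) σ∈)
    insertions-⊆ : concatMap (insertions (suc n)) (perms n) ⊆ perms (suc n)
    insertions-⊆ w∈ with find (∈-concatMap⁻ (insertions (suc n)) w∈)
    ... | σ , σ∈ , w∈σ = ∈-perms⁺ (∈-insertions⇒IsPerm σ∈ w∈σ)

module DescentRecurrence where

  open import Data.Bool using (Bool; true; false; _∧_)
  open import Data.List using (List; []; _∷_; [_]; map; concatMap; length; filterᵇ)
  open import Data.List.Properties using (map-∘; map-id; map-cong-local)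
  open import Data.List.Relation.Unary.All as All using (All; []; _∷_)
  open import Data.List.Membership.Propositional using (_∈_)
  open import Data.List.Relation.Binary.Permutation.Propositional.Properties using (↭-length; filter-↭)
  open import Data.Nat using (zero; suc; _+_; _*_; _∸_; _<_; _≤_; z≤n; s≤s; _≡ᵇ_; _<ᵇ_)
  open import Data.Nat.ListAction using (sum)
  open import Data.Nat.Properties
    using (≡ᵇ⇒≡; <⇒<ᵇ; <ᵇ⇒<; <-asym; ≤-trans; m≤m+n; m≤n+m; +-comm; *-comm; *-zeroʳ;
           *-identityʳ; +-identityʳ; m+n∸n≡m; m+n∸m≡n; +-∸-assoc; +-commutativeSemigroup)
  open import Algebra.Properties.CommutativeSemigroup +-commutativeSemigroup using (x∙yz≈y∙xz)
  open import Data.Product using (_,_)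
  open import Function using (_∘_)
  open import Relation.Binary.PropositionalEquality
    using (refl; sym; trans; cong; cong₂; subst; module ≡-Reasoning)
  open import Relation.Nullary using (contradiction)
  open import Relation.Nullary.Decidable using (T?)
  open Lists
  open Permutations

  shiftBy : ℕ → (ℕ → ℕ) → ℕ → ℕ
  shiftBy zero p s = p s
  shiftBy (suc t) p zero = 0
  shiftBy (suc t) p (suc s) = shiftBy t p s

  length-filterᵇ-shift : ∀ {A : Set} t (f : A → ℕ) xs s →
    length (filterᵇ (λ x → t + f x ≡ᵇ s) xs)
      ≡ shiftBy t (λ s → length (filterᵇ (λ x → f x ≡ᵇ s) xs)) s
  length-filterᵇ-shift zero f xs s = refl
  length-filterᵇ-shift (suc t) f xs (suc s) = length-filterᵇ-shift t f xs s
  length-filterᵇ-shift (suc t) f [] zero = refl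
  length-filterᵇ-shift (suc t) f (x ∷ xs) zero = length-filterᵇ-shift (suc t) f xs zero

  ind≤1 : ∀ b → ind b ≤ 1
  ind≤1 true = s≤s z≤n
  ind≤1 false = z≤n

  ind-≡ᵇ-subst : ∀ d s (f : ℕ → ℕ) → ind (d ≡ᵇ s) * f d ≡ ind (d ≡ᵇ s) * f s
  ind-≡ᵇ-subst d s f with d ≡ᵇ s | ≡ᵇ⇒≡ d s
  ... | true | d≡s = cong (λ x → 1 * f x) (d≡s _)
  ... | false | _ = refl

  zeros : List ℕ → ℕ
  zeros bs = sum (map (λ b → ind (b ≡ᵇ 0)) bs)

  zeros+sum≡length : ∀ {bs} → All (_≤ 1) bs → zeros bs + sum bs ≡ length bs
  zeros+sum≡length [] = refl
  zeros+sum≡length {zero ∷ bs} (_ ∷ bits) = cong suc (zeros+sum≡length bits)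
  zeros+sum≡length {suc zero ∷ bs} (_ ∷ bits) = trans (+-comm (zeros bs) (suc (sum bs)))
    (cong suc (trans (+-comm (sum bs) (zeros bs)) (zeros+sum≡length bits)))
  zeros+sum≡length {suc (suc b) ∷ bs} (s≤s () ∷ _)

  All≤sum : ∀ bs → All (_≤ sum bs) bs
  All≤sum [] = []
  All≤sum (b ∷ bs) =
    m≤m+n b (sum bs) ∷ All.map (λ {c} c≤ → ≤-trans c≤ (m≤n+m (sum bs) b)) (All≤sum bs)

  ind-∸-bit : ∀ d s {b} → b ≤ 1 → b ≤ d →
    ind (d ∸ b ≡ᵇ s) ≡ ind (d ≡ᵇ s) * ind (b ≡ᵇ 0) + ind (d ≡ᵇ suc s) * b
  ind-∸-bit d s {zero} _ _ =
    sym (trans (cong₂ _+_ (*-identityʳ (ind (d ≡ᵇ s))) (*-zeroʳ (ind (d ≡ᵇ suc s))))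
               (+-identityʳ _))
  ind-∸-bit (suc d) s {suc zero} _ _ = sym (cong₂ _+_ (*-zeroʳ (ind (suc d ≡ᵇ s))) (*-identityʳ _))
  ind-∸-bit d s {suc (suc b)} (s≤s ()) _

  count-∸-bits : ∀ d s {bs} → All (_≤ 1) bs → All (_≤ d) bs →
    sum (map (λ b → ind (d ∸ b ≡ᵇ s)) bs)
      ≡ ind (d ≡ᵇ s) * zeros bs + ind (d ≡ᵇ suc s) * sum bs
  count-∸-bits d s {bs} bits bounded = begin
    sum (map (λ b → ind (d ∸ b ≡ᵇ s)) bs)
      ≡⟨ cong sum (map-cong-local (All.zipWith (λ (b≤1 , b≤d) → ind-∸-bit d s b≤1 b≤d)
                                                (bits , bounded))) ⟩
    sum (map (λ b → ind (d ≡ᵇ s) * ind (b ≡ᵇ 0) + ind (d ≡ᵇ suc s) * b) bs)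
      ≡⟨ sum-map-linear (ind (d ≡ᵇ s)) (ind (d ≡ᵇ suc s)) _ (λ b → b) bs ⟩
    ind (d ≡ᵇ s) * zeros bs + ind (d ≡ᵇ suc s) * sum (map (λ b → b) bs)
      ≡⟨ cong (λ z → ind (d ≡ᵇ s) * zeros bs + ind (d ≡ᵇ suc s) * sum z) (map-id bs) ⟩
    ind (d ≡ᵇ s) * zeros bs + ind (d ≡ᵇ suc s) * sum bs ∎
    where open ≡-Reasoning

  <⇒<ᵇ≡true : ∀ {a v} → a < v → (a <ᵇ v) ≡ true
  <⇒<ᵇ≡true {a} {v} a<v with a <ᵇ v | <⇒<ᵇ a<v
  ... | true | _ = refl

  <⇒>ᵇ≡false : ∀ {a v} → a < v → (v <ᵇ a) ≡ false
  <⇒>ᵇ≡false {a} {v} a<v with v <ᵇ a | <ᵇ⇒< v a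
  ... | false | _ = refl
  ... | true | v<a = contradiction (v<a _) (<-asym a<v)

  module Insertion (X : Subset) where

    descentAt : ℕ → ℕ → ℕ
    descentAt a b = ind ((b <ᵇ a) ∧ X a)

    -- Entry i of  deficits t σ  is how far desX of the i-th insertion of a new maximum v into σ falls
    -- below  t + desX X σ , where  t = ind (X v)  (see desX-insertions).
    deficitsAfter : ℕ → ℕ → List ℕ → List ℕ
    deficitsAfter t a [] = [ t ]
    deficitsAfter t a (b ∷ τ) = descentAt a b ∷ deficitsAfter t b τ

    deficits : ℕ → List ℕ → List ℕ
    deficits t [] = [ t ]
    deficits t (a ∷ τ) = 0 ∷ deficitsAfter t a τ

    sum-deficitsAfter : ∀ t a τ → sum (deficitsAfter t a τ) ≡ t + desX X (a ∷ τ)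
    sum-deficitsAfter t a [] = refl
    sum-deficitsAfter t a (b ∷ τ) rewrite sum-deficitsAfter t b τ =
      x∙yz≈y∙xz (descentAt a b) t (desX X (b ∷ τ))

    sum-deficits : ∀ t σ → sum (deficits t σ) ≡ t + desX X σ
    sum-deficits t [] = refl
    sum-deficits t (a ∷ τ) = sum-deficitsAfter t a τ

    length-deficits : ∀ t σ → length (deficits t σ) ≡ suc (length σ)
    length-deficits t [] = refl
    length-deficits t (a ∷ τ) = cong suc (after a τ)
      where
      after : ∀ a τ → length (deficitsAfter t a τ) ≡ suc (length τ)
      after a [] = refl
      after a (b ∷ τ) = cong suc (after b τ)

    deficits≤1 : ∀ {t} σ → t ≤ 1 → All (_≤ 1) (deficits t σ)
    deficits≤1 [] t≤1 = t≤1 ∷ []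
    deficits≤1 (a ∷ τ) t≤1 = z≤n ∷ after a τ
      where
      after : ∀ a τ → All (_≤ 1) (deficitsAfter _ a τ)
      after a [] = t≤1 ∷ []
      after a (b ∷ τ) = ind≤1 ((b <ᵇ a) ∧ X a) ∷ after b τ

    desX-after-insertions : ∀ {v} a τ → a < v → All (_< v) τ →
      map (desX X) (map (a ∷_) (insertions v τ))
        ≡ map (ind (X v) + desX X (a ∷ τ) ∸_) (deficitsAfter (ind (X v)) a τ)
    desX-after-insertions {v} a [] a<v [] rewrite <⇒>ᵇ≡false a<v =
      cong [_] (sym (m+n∸m≡n (ind (X v)) 0))
    desX-after-insertions {v} a (b ∷ τ) a<v (b<v ∷ τ<v) = cong₂ _∷_ (sym front) rest
      where
      t = ind (X v)
      e = descentAt a b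
      d = desX X (b ∷ τ)
      front : t + (e + d) ∸ e ≡ desX X (a ∷ v ∷ b ∷ τ)
      front rewrite <⇒>ᵇ≡false a<v | <⇒<ᵇ≡true b<v =
        trans (cong (_∸ e) (x∙yz≈y∙xz t e d)) (m+n∸m≡n e (t + d))
      desX-∷-∷ : ∀ ws →
        map (desX X) (map (a ∷_) (map (b ∷_) ws)) ≡ map (e +_) (map (desX X) (map (b ∷_) ws))
      desX-∷-∷ [] = refl
      desX-∷-∷ (w ∷ ws) = cong (_ ∷_) (desX-∷-∷ ws)
      bounded : All (_≤ t + d) (deficitsAfter t b τ)
      bounded = subst (λ n → All (_≤ n) (deficitsAfter t b τ)) (sum-deficitsAfter t b τ) (All≤sum _)
      regroup : ∀ {x} → x ≤ t + d → e + (t + d ∸ x) ≡ t + (e + d) ∸ x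
      regroup {x} x≤ = trans (sym (+-∸-assoc e x≤)) (cong (_∸ x) (x∙yz≈y∙xz e t d))
      rest : map (desX X) (map (a ∷_) (map (b ∷_) (insertions v τ)))
               ≡ map (t + (e + d) ∸_) (deficitsAfter t b τ)
      rest = begin
        map (desX X) (map (a ∷_) (map (b ∷_) (insertions v τ)))
          ≡⟨ desX-∷-∷ (insertions v τ) ⟩
        map (e +_) (map (desX X) (map (b ∷_) (insertions v τ)))
          ≡⟨ cong (map (e +_)) (desX-after-insertions b τ b<v τ<v) ⟩
        map (e +_) (map (t + d ∸_) (deficitsAfter t b τ))
          ≡⟨ map-∘ (deficitsAfter t b τ) ⟨
        map (λ x → e + (t + d ∸ x)) (deficitsAfter t b τ)
          ≡⟨ map-cong-local (All.map regroup bounded) ⟩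
        map (t + (e + d) ∸_) (deficitsAfter t b τ) ∎
        where open ≡-Reasoning

    desX-insertions : ∀ {v} σ → All (_< v) σ →
      map (desX X) (insertions v σ) ≡ map (ind (X v) + desX X σ ∸_) (deficits (ind (X v)) σ)
    desX-insertions {v} [] [] = cong [_] (sym (m+n∸m≡n (ind (X v)) 0))
    desX-insertions {v} (a ∷ τ) (a<v ∷ τ<v) rewrite <⇒<ᵇ≡true a<v =
      cong (ind (X v) + desX X (a ∷ τ) ∷_) (desX-after-insertions a τ a<v τ<v)

    count-insertions : ∀ {v} σ → All (_< v) σ → ∀ s → let D = ind (X v) + desX X σ in
      length (filterᵇ (λ w → desX X w ≡ᵇ s) (insertions v σ))
        ≡ (suc (length σ) ∸ s) * ind (D ≡ᵇ s) + suc s * ind (D ≡ᵇ suc s)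
    count-insertions {v} σ σ<v s = begin
      length (filterᵇ (λ w → desX X w ≡ᵇ s) (insertions v σ))
        ≡⟨ length-filterᵇ _ (insertions v σ) ⟩
      sum (map (λ w → ind (desX X w ≡ᵇ s)) (insertions v σ))
        ≡⟨ cong sum (map-∘ (insertions v σ)) ⟩
      sum (map (λ x → ind (x ≡ᵇ s)) (map (desX X) (insertions v σ)))
        ≡⟨ cong (sum ∘ map (λ x → ind (x ≡ᵇ s))) (desX-insertions σ σ<v) ⟩
      sum (map (λ x → ind (x ≡ᵇ s)) (map (D ∸_) B))
        ≡⟨ cong sum (map-∘ B) ⟨
      sum (map (λ b → ind (D ∸ b ≡ᵇ s)) B)
        ≡⟨ count-∸-bits D s bits (subst (λ n → All (_≤ n) B) sumB (All≤sum B)) ⟩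
      ind (D ≡ᵇ s) * zeros B + ind (D ≡ᵇ suc s) * sum B
        ≡⟨ cong₂ (λ z o → ind (D ≡ᵇ s) * z + ind (D ≡ᵇ suc s) * o) zerosB sumB ⟩
      ind (D ≡ᵇ s) * (suc (length σ) ∸ D) + ind (D ≡ᵇ suc s) * D
        ≡⟨ cong₂ _+_ (ind-≡ᵇ-subst D s (suc (length σ) ∸_)) (ind-≡ᵇ-subst D (suc s) λ x → x) ⟩
      ind (D ≡ᵇ s) * (suc (length σ) ∸ s) + ind (D ≡ᵇ suc s) * suc s
        ≡⟨ cong₂ _+_ (*-comm (ind (D ≡ᵇ s)) _) (*-comm (ind (D ≡ᵇ suc s)) _) ⟩
      (suc (length σ) ∸ s) * ind (D ≡ᵇ s) + suc s * ind (D ≡ᵇ suc s) ∎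
      where
      open ≡-Reasoning
      D = ind (X v) + desX X σ
      B = deficits (ind (X v)) σ
      bits = deficits≤1 σ (ind≤1 (X v))
      sumB : sum B ≡ D
      sumB = sum-deficits (ind (X v)) σ
      zerosB : zeros B ≡ suc (length σ) ∸ D
      zerosB = begin
        zeros B                    ≡⟨ m+n∸n≡m (zeros B) (sum B) ⟨
        zeros B + sum B ∸ sum B    ≡⟨ cong₂ _∸_ (zeros+sum≡length bits) sumB ⟩
        length B ∸ D               ≡⟨ cong (_∸ D) (length-deficits (ind (X v)) σ) ⟩
        suc (length σ) ∸ D         ∎

  P-suc : ∀ (X : Subset) n s → let q = shiftBy (ind (X (suc n))) (P X n) in
    P X (suc n) s ≡ (suc n ∸ s) * q s + suc s * q (suc s)
  P-suc X n s = begin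
    length (filterᵇ (desX≡ s) (perms (suc n)))
      ≡⟨ ↭-length (filter-↭ (T? ∘ desX≡ s) (perms-suc↭ n)) ⟩
    length (filterᵇ (desX≡ s) (concatMap (insertions (suc n)) (perms n)))
      ≡⟨ length-filterᵇ-concatMap (desX≡ s) (insertions (suc n)) (perms n) ⟩
    sum (map (λ σ → length (filterᵇ (desX≡ s) (insertions (suc n) σ))) (perms n))
      ≡⟨ cong sum (map-cong-local (All.tabulate count-perm)) ⟩
    sum (map (λ σ → (suc n ∸ s) * δ s σ + suc s * δ (suc s) σ) (perms n))
      ≡⟨ sum-map-linear (suc n ∸ s) (suc s) (δ s) (δ (suc s)) (perms n) ⟩
    (suc n ∸ s) * sum (map (δ s) (perms n)) + suc s * sum (map (δ (suc s)) (perms n))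
      ≡⟨ cong₂ (λ x y → (suc n ∸ s) * x + suc s * y) (count-shifted s) (count-shifted (suc s)) ⟩
    (suc n ∸ s) * shiftBy t (P X n) s + suc s * shiftBy t (P X n) (suc s) ∎
    where
    open ≡-Reasoning
    open Insertion X
    t = ind (X (suc n))
    desX≡ : ℕ → List ℕ → Bool
    desX≡ s w = desX X w ≡ᵇ s
    δ : ℕ → List ℕ → ℕ
    δ s σ = ind (t + desX X σ ≡ᵇ s)
    count-perm : ∀ {σ} → σ ∈ perms n →
      length (filterᵇ (desX≡ s) (insertions (suc n) σ)) ≡ (suc n ∸ s) * δ s σ + suc s * δ (suc s) σ
    count-perm {σ} σ∈ with ∈-perms⇒bounded σ∈
    ... | len , σ<v =
      trans (count-insertions σ σ<v s) (cong (λ k → (suc k ∸ s) * δ s σ + suc s * δ (suc s) σ) len)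
    count-shifted : ∀ s → sum (map (δ s) (perms n)) ≡ shiftBy t (P X n) s
    count-shifted s =
      trans (sym (length-filterᵇ _ (perms n))) (length-filterᵇ-shift t (desX X) (perms n) s)

module Differences where

  open import Data.Nat as ℕ using (zero; suc; _∸_; _<_; s≤s)
  import Data.Nat.Properties as ℕ
  open import Data.Nat.Combinatorics using (_C_; nCk+nC[k+1]≡[n+1]C[k+1])
  open import Data.Integer using (ℤ; +_; 0ℤ; 1ℤ; -1ℤ; _+_; _-_; _*_; _^_)
  open import Data.Integer.Properties using (+-identityʳ; +-identityˡ; +-assoc; *-identityˡ; *-zeroʳ; pos-+)
  open import Function using (_∘_)
  open import Data.Integer.Tactic.RingSolver using (solve-∀)
  open import Data.List using (List; []; _∷_; [_]; _++_; map; upTo)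
  open import Data.List.Properties using (upTo-∷ʳ; map-++)
  open import Relation.Binary.PropositionalEquality
    using (refl; sym; trans; cong; cong₂; module ≡-Reasoning)
  open import Relation.Nullary using (contradiction)

  -- Backward difference and delay, with the convention f (-1) = 0.
  Δ : (ℕ → ℤ) → ℕ → ℤ
  Δ f zero = f zero
  Δ f (suc k) = f (suc k) - f k

  delay : (ℕ → ℤ) → ℕ → ℤ
  delay f zero = 0ℤ
  delay f (suc k) = f k

  Δ^ : ℕ → (ℕ → ℤ) → ℕ → ℤ
  Δ^ zero f = f
  Δ^ (suc N) f = Δ (Δ^ N f)

  Δ-cong : ∀ {f g} → (∀ k → f k ≡ g k) → ∀ k → Δ f k ≡ Δ g k
  Δ-cong f≡g zero = f≡g zero
  Δ-cong f≡g (suc k) = cong₂ _-_ (f≡g (suc k)) (f≡g k)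

  Δ^-cong : ∀ N {f g} → (∀ k → f k ≡ g k) → ∀ k → Δ^ N f k ≡ Δ^ N g k
  Δ^-cong zero f≡g = f≡g
  Δ^-cong (suc N) f≡g = Δ-cong (Δ^-cong N f≡g)

  delay-cong : ∀ {f g} → (∀ k → f k ≡ g k) → ∀ k → delay f k ≡ delay g k
  delay-cong f≡g zero = refl
  delay-cong f≡g (suc k) = f≡g k

  Δ-+ : ∀ f g k → Δ (λ j → f j + g j) k ≡ Δ f k + Δ g k
  Δ-+ f g zero = refl
  Δ-+ f g (suc k) = regroup (f (suc k)) (g (suc k)) (f k) (g k)
    where
    regroup : ∀ x y u v → (x + y) - (u + v) ≡ (x - u) + (y - v)
    regroup = solve-∀

  Δ-* : ∀ a f k → Δ (λ j → a * f j) k ≡ a * Δ f k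
  Δ-* a f zero = refl
  Δ-* a f (suc k) = distrib a (f (suc k)) (f k)
    where
    distrib : ∀ a x u → a * x - a * u ≡ a * (x - u)
    distrib = solve-∀

  Δ-delay : ∀ f k → Δ (delay f) k ≡ delay (Δ f) k
  Δ-delay f zero = refl
  Δ-delay f (suc zero) = +-identityʳ (f zero)
  Δ-delay f (suc (suc k)) = refl

  Δ-product : ∀ {μ : ℕ → ℤ} → (∀ k → μ (suc k) ≡ μ k + 1ℤ) → ∀ f k →
    Δ (λ j → μ j * f j) k ≡ μ k * Δ f k + delay f k
  Δ-product μ-step f zero = sym (+-identityʳ _)
  Δ-product {μ} μ-step f (suc k) rewrite μ-step k = rule (μ k) (f (suc k)) (f k)
    where
    rule : ∀ m x y → (m + 1ℤ) * x - m * y ≡ (m + 1ℤ) * (x - y) + y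
    rule = solve-∀

  Δ^-product : ∀ {μ : ℕ → ℤ} → (∀ k → μ (suc k) ≡ μ k + 1ℤ) → ∀ N f k →
    Δ^ (suc N) (λ j → μ j * f j) k ≡ μ k * Δ^ (suc N) f k + + suc N * delay (Δ^ N f) k
  Δ^-product {μ} μ-step zero f k =
    trans (Δ-product {μ} μ-step f k) (cong (λ x → μ k * Δ f k + x) (sym (*-identityˡ (delay f k))))
  Δ^-product {μ} μ-step (suc N) f k = begin
    Δ (Δ^ (suc N) (λ j → μ j * f j)) k
      ≡⟨ Δ-cong (Δ^-product {μ} μ-step N f) k ⟩
    Δ (λ j → μ j * F j + + suc N * delay G j) k
      ≡⟨ Δ-+ (λ j → μ j * F j) _ k ⟩
    Δ (λ j → μ j * F j) k + Δ (λ j → + suc N * delay G j) k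
      ≡⟨ cong₂ _+_ (Δ-product {μ} μ-step F k) (Δ-* (+ suc N) (delay G) k) ⟩
    (μ k * Δ F k + delay F k) + + suc N * Δ (delay G) k
      ≡⟨ cong (λ x → (μ k * Δ F k + delay F k) + + suc N * x) (Δ-delay G k) ⟩
    (μ k * Δ F k + delay F k) + + suc N * delay F k
      ≡⟨ collect (μ k * Δ F k) (delay F k) (+ suc N) ⟩
    μ k * Δ F k + (1ℤ + + suc N) * delay F k
      ≡⟨ cong (λ c → μ k * Δ F k + c * delay F k) (pos-+ 1 (suc N)) ⟨
    μ k * Δ F k + + suc (suc N) * delay F k ∎
    where
    open ≡-Reasoning
    F = Δ^ (suc N) f
    G = Δ^ N f
    collect : ∀ x y c → (x + y) + c * y ≡ x + (1ℤ + c) * y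
    collect = solve-∀

  Σ< : ℕ → (ℕ → ℤ) → ℤ
  Σ< zero f = 0ℤ
  Σ< (suc k) f = Σ< k f + f k

  Σ<-cong : ∀ k {f g} → (∀ {r} → r < k → f r ≡ g r) → Σ< k f ≡ Σ< k g
  Σ<-cong zero f≡g = refl
  Σ<-cong (suc k) f≡g =
    cong₂ _+_ (Σ<-cong k (λ r<k → f≡g (ℕ.m<n⇒m<1+n r<k))) (f≡g (ℕ.n<1+n k))

  Σ<-zero : ∀ k {f} → (∀ {r} → r < k → f r ≡ 0ℤ) → Σ< k f ≡ 0ℤ
  Σ<-zero zero f≡0 = refl
  Σ<-zero (suc k) f≡0 =
    cong₂ _+_ (Σ<-zero k (λ r<k → f≡0 (ℕ.m<n⇒m<1+n r<k))) (f≡0 (ℕ.n<1+n k))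

  Σ<-sub : ∀ k f g → Σ< k (λ r → f r - g r) ≡ Σ< k f - Σ< k g
  Σ<-sub zero f g = refl
  Σ<-sub (suc k) f g rewrite Σ<-sub k f g = regroup (Σ< k f) (Σ< k g) (f k) (g k)
    where
    regroup : ∀ a b x y → (a - b) + (x - y) ≡ (a + x) - (b + y)
    regroup = solve-∀

  *-Σ< : ∀ a k f → a * Σ< k f ≡ Σ< k (λ r → a * f r)
  *-Σ< a zero f = *-zeroʳ a
  *-Σ< a (suc k) f rewrite sym (*-Σ< a k f) = distrib a (Σ< k f) (f k)
    where
    distrib : ∀ a x y → a * (x + y) ≡ a * x + a * y
    distrib = solve-∀

  sumℤ-upTo : ∀ k f → sumℤ (map f (upTo k)) ≡ Σ< k f
  sumℤ-upTo zero f = refl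
  sumℤ-upTo (suc k) f = begin
    sumℤ (map f (upTo (suc k)))              ≡⟨ cong (sumℤ ∘ map f) (upTo-∷ʳ k) ⟨
    sumℤ (map f (upTo k ++ [ k ]))           ≡⟨ cong sumℤ (map-++ f (upTo k) [ k ]) ⟩
    sumℤ (map f (upTo k) ++ [ f k ])         ≡⟨ sumℤ-++ (map f (upTo k)) ⟩
    sumℤ (map f (upTo k)) + (f k + 0ℤ)       ≡⟨ cong₂ _+_ (sumℤ-upTo k f) (+-identityʳ (f k)) ⟩
    Σ< k f + f k                             ∎
    where
    open ≡-Reasoning
    sumℤ-++ : ∀ xs {ys} → sumℤ (xs ++ ys) ≡ sumℤ xs + sumℤ ys
    sumℤ-++ [] = sym (+-identityˡ _)
    sumℤ-++ (x ∷ xs) = trans (cong (λ y → x + y) (sumℤ-++ xs)) (sym (+-assoc x _ _))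

  binomialΔ : ℕ → (ℕ → ℤ) → ℕ → ℤ
  binomialΔ N f k = Σ< (suc k) (λ r → -1ℤ ^ (k ∸ r) * (+ (N C (k ∸ r)) * f r))

  binomialΔ-zero : ∀ f k → binomialΔ 0 f k ≡ f k
  binomialΔ-zero f k = begin
    Σ< k term + term k    ≡⟨ cong₂ _+_ (Σ<-zero k vanish) diagonal ⟩
    0ℤ + f k              ≡⟨ +-identityˡ (f k) ⟩
    f k                   ∎
    where
    open ≡-Reasoning
    term : ℕ → ℤ
    term r = -1ℤ ^ (k ∸ r) * (+ (0 C (k ∸ r)) * f r)
    vanish : ∀ {r} → r < k → term r ≡ 0ℤ
    vanish {r} r<k with k ∸ r | ℕ.m>n⇒m∸n≢0 r<k
    ... | zero | k∸r≢0 = contradiction refl k∸r≢0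
    ... | suc j | _ = *-zeroʳ (-1ℤ ^ suc j)
    diagonal : term k ≡ f k
    diagonal rewrite ℕ.n∸n≡0 k = trans (*-identityˡ _) (*-identityˡ (f k))

  binomialΔ-suc : ∀ N f k → binomialΔ (suc N) f (suc k) ≡ binomialΔ N f (suc k) - binomialΔ N f k
  binomialΔ-suc N f k = begin
    Σ< (suc k) T + T (suc k)                     ≡⟨ cong₂ _+_ (Σ<-cong (suc k) pascal) last ⟩
    Σ< (suc k) (λ r → U r - V r) + U (suc k)     ≡⟨ cong (_+ U (suc k)) (Σ<-sub (suc k) U V) ⟩
    (Σ< (suc k) U - Σ< (suc k) V) + U (suc k)    ≡⟨ regroup (Σ< (suc k) U) (Σ< (suc k) V) (U (suc k)) ⟩
    (Σ< (suc k) U + U (suc k)) - Σ< (suc k) V    ∎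
    where
    open ≡-Reasoning
    T U V : ℕ → ℤ
    T r = -1ℤ ^ (suc k ∸ r) * (+ (suc N C (suc k ∸ r)) * f r)
    U r = -1ℤ ^ (suc k ∸ r) * (+ (N C (suc k ∸ r)) * f r)
    V r = -1ℤ ^ (k ∸ r) * (+ (N C (k ∸ r)) * f r)
    pascal : ∀ {r} → r < suc k → T r ≡ U r - V r
    pascal {r} (s≤s r≤k) rewrite ℕ.+-∸-assoc 1 r≤k
                               | sym (nCk+nC[k+1]≡[n+1]C[k+1] N (k ∸ r))
                               | pos-+ (N C (k ∸ r)) (N C suc (k ∸ r)) =
      split (-1ℤ ^ (k ∸ r)) (+ (N C (k ∸ r))) (+ (N C suc (k ∸ r))) (f r)
      where
      split : ∀ (s a b x : ℤ) → (-1ℤ * s) * ((a + b) * x) ≡ (-1ℤ * s) * (b * x) - s * (a * x)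
      split = solve-∀
    last : T (suc k) ≡ U (suc k)
    last rewrite ℕ.n∸n≡0 k = refl
    regroup : ∀ a b t → (a - b) + t ≡ (a + t) - b
    regroup = solve-∀

  Δ^-binomial : ∀ N f k → Δ^ N f k ≡ binomialΔ N f k
  Δ^-binomial zero f k = sym (binomialΔ-zero f k)
  Δ^-binomial (suc N) f zero = Δ^-binomial N f zero
  Δ^-binomial (suc N) f (suc k) rewrite Δ^-binomial N f (suc k) | Δ^-binomial N f k =
    sym (binomialΔ-suc N f k)

  eulerStep : ℕ → ℕ → (ℕ → ℤ) → ℕ → ℤ
  eulerStep a N f k = + (k ℕ.+ a) * Δ f k + + N * delay f k

  eulerStep-cong : ∀ a N {f g} → (∀ k → f k ≡ g k) →
                   ∀ k → eulerStep a N f k ≡ eulerStep a N g k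
  eulerStep-cong a N f≡g k =
    cong₂ (λ x y → + (k ℕ.+ a) * x + + N * y) (Δ-cong f≡g k) (delay-cong f≡g k)

module Reversal where

  open import Data.Nat using (zero; suc; _+_; _*_; _∸_; _<_; s≤s; _<?_; _≤?_)
  open import Data.Nat.Properties
    using (+-suc; *-zeroʳ; +-identityʳ; m+n∸n≡m; m+n∸m≡n; m+[n∸m]≡n; m≤n⇒∃[o]m+o≡n;
           m≤n⇒m∸n≡0; ≮⇒≥; ≰⇒>; ≤-refl)
  open import Data.Nat.Tactic.RingSolver using (solve-∀)
  open import Data.Product using (_,_)
  open import Relation.Binary.PropositionalEquality
    using (refl; sym; trans; cong; cong₂; module ≡-Reasoning)
  open import Relation.Nullary using (yes; no)
  open DescentRecurrence using (shiftBy)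

  VanishesAbove : ℕ → (ℕ → ℕ) → Set
  VanishesAbove M p = ∀ {s} → M < s → p s ≡ 0

  shiftBy-vanishes : ∀ t {M p} → VanishesAbove M p → VanishesAbove (t + M) (shiftBy t p)
  shiftBy-vanishes zero p0 = p0
  shiftBy-vanishes (suc t) p0 {suc s} (s≤s M<s) = shiftBy-vanishes t p0 M<s

  -- rev M p k = p (M ∸ k) for k ≤ M and 0 beyond; with M = |X_n| it turns the descent count s into
  -- k = |X_n| − s.
  rev : ℕ → (ℕ → ℕ) → ℕ → ℕ
  rev M p zero = p M
  rev zero p (suc k) = 0
  rev (suc M) p (suc k) = rev M p k

  rev-+ : ∀ k s p → rev (k + s) p k ≡ p s
  rev-+ zero s p = refl
  rev-+ (suc k) s p = rev-+ k s p

  rev-vanishes : ∀ M p → VanishesAbove M (rev M p)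
  rev-vanishes zero p {suc k} _ = refl
  rev-vanishes (suc M) p {suc k} (s≤s M<k) = rev-vanishes M p M<k

  rev-suc-shift : ∀ M {p q : ℕ → ℕ} → p zero ≡ 0 → (∀ s → p (suc s) ≡ q s) →
    ∀ k → rev (suc M) p k ≡ rev M q k
  rev-suc-shift M p0 pq zero = pq M
  rev-suc-shift zero p0 pq (suc zero) = p0
  rev-suc-shift zero p0 pq (suc (suc k)) = refl
  rev-suc-shift (suc M) p0 pq (suc k) = rev-suc-shift M p0 pq k

  rev-shiftBy : ∀ t M p k → rev (t + M) (shiftBy t p) k ≡ rev M p k
  rev-shiftBy zero M p k = refl
  rev-shiftBy (suc t) M p k = trans (rev-suc-shift (t + M) refl (λ _ → refl) k) (rev-shiftBy t M p k)

  module Reversed {a M N : ℕ} (a+M≡N : a + M ≡ N) {p′ q : ℕ → ℕ} (q0 : VanishesAbove M q)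
    (rec : ∀ s → p′ s ≡ (N ∸ s) * q s + suc s * q (suc s)) where

    rev-rec-zero : rev M p′ zero ≡ a * rev M q zero
    rev-rec-zero = begin
      p′ M                                ≡⟨ rec M ⟩
      (N ∸ M) * q M + suc M * q (suc M)   ≡⟨ cong₂ (λ x y → x * q M + suc M * y) N∸M≡a (q0 ≤-refl) ⟩
      a * q M + suc M * 0                 ≡⟨ cong (λ x → a * q M + x) (*-zeroʳ (suc M)) ⟩
      a * q M + 0                         ≡⟨ +-identityʳ _ ⟩
      a * q M                             ∎
      where
      open ≡-Reasoning
      N∸M≡a : N ∸ M ≡ a
      N∸M≡a = trans (cong (_∸ M) (sym a+M≡N)) (m+n∸n≡m a M)

    rev-rec-suc : ∀ k → rev M p′ (suc k) ≡ (suc k + a) * rev M q (suc k) + (M ∸ k) * rev M q k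
    rev-rec-suc k with k <? M
    ... | no k≮M = begin
      rev M p′ (suc k)                                      ≡⟨ rev-vanishes M p′ (s≤s M≤k) ⟩
      0                                                     ≡⟨ cong₂ _+_ right-zero left-zero ⟨
      (suc k + a) * rev M q (suc k) + (M ∸ k) * rev M q k   ∎
      where
      open ≡-Reasoning
      M≤k = ≮⇒≥ k≮M
      right-zero : (suc k + a) * rev M q (suc k) ≡ 0
      right-zero = trans (cong ((suc k + a) *_) (rev-vanishes M q (s≤s M≤k))) (*-zeroʳ (suc k + a))
      left-zero : (M ∸ k) * rev M q k ≡ 0
      left-zero = cong (_* rev M q k) (m≤n⇒m∸n≡0 M≤k)
    ... | yes k<M with m≤n⇒∃[o]m+o≡n k<M
    ... | s , refl = begin
      rev (suc k + s) p′ (suc k)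
        ≡⟨ rev-+ (suc k) s p′ ⟩
      p′ s
        ≡⟨ rec s ⟩
      (N ∸ s) * q s + suc s * q (suc s)
        ≡⟨ cong₂ (λ x y → x * q s + y * q (suc s)) N∸s≡1+k+a (sym (m+n∸m≡n k (suc s))) ⟩
      (suc k + a) * q s + (k + suc s ∸ k) * q (suc s)
        ≡⟨ cong₂ (λ x y → (suc k + a) * x + (k + suc s ∸ k) * y) (rev-+ (suc k) s q) (rev-+ k (suc s) q) ⟨
      (suc k + a) * rev (suc k + s) q (suc k) + (k + suc s ∸ k) * rev (k + suc s) q k
        ≡⟨ cong (λ m → (suc k + a) * rev (suc k + s) q (suc k) + (m ∸ k) * rev m q k) (+-suc k s) ⟩
      (suc k + a) * rev (suc k + s) q (suc k) + (suc k + s ∸ k) * rev (suc k + s) q k ∎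
      where
      open ≡-Reasoning
      reorder : ∀ a k s → a + (suc k + s) ≡ suc k + a + s
      reorder = solve-∀
      N∸s≡1+k+a : N ∸ s ≡ suc k + a
      N∸s≡1+k+a = trans (cong (_∸ s) (trans (sym a+M≡N) (reorder a k s))) (m+n∸n≡m (suc k + a) s)

    rev-weights : ∀ k → suc N * rev M q k ≡ (suc k + a + (M ∸ k)) * rev M q k
    rev-weights k with k ≤? M
    ... | yes k≤M = cong (λ x → suc x * rev M q k) (trans (sym a+M≡N) split)
      where
      regroup : ∀ a k d → a + (k + d) ≡ k + a + d
      regroup = solve-∀
      split : a + M ≡ k + a + (M ∸ k)
      split = trans (cong (a +_) (sym (m+[n∸m]≡n k≤M))) (regroup a k (M ∸ k))
    ... | no k≰M rewrite rev-vanishes M q (≰⇒> k≰M) =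
      trans (*-zeroʳ (suc N)) (sym (*-zeroʳ (suc k + a + (M ∸ k))))

module Binomial where

  open import Data.Nat using (zero; suc; _+_; _*_)
  open import Data.Nat.Properties using (+-comm; +-suc; *-zeroʳ; *-identityʳ; +-identityʳ; m+n∸n≡m; m≤n+m)
  open import Data.Nat.Combinatorics using (_C_; nCk+nC[k+1]≡[n+1]C[k+1]; nC1≡n; nCk≡nC[n∸k])
  open import Data.Nat.Tactic.RingSolver using (solve-∀)
  open import Relation.Binary.PropositionalEquality
    using (refl; sym; trans; cong; cong₂; module ≡-Reasoning)

  [1+k]*[1+n]C[1+k]≡[1+n]*nCk : ∀ n k → suc k * (suc n C suc k) ≡ suc n * (n C k)
  [1+k]*[1+n]C[1+k]≡[1+n]*nCk zero zero = refl
  [1+k]*[1+n]C[1+k]≡[1+n]*nCk zero (suc k) = *-zeroʳ (suc (suc k))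
  [1+k]*[1+n]C[1+k]≡[1+n]*nCk (suc n) zero =
    trans (+-identityʳ _) (trans (nC1≡n (suc (suc n))) (sym (*-identityʳ _)))
  [1+k]*[1+n]C[1+k]≡[1+n]*nCk (suc n) (suc k) = begin
    suc (suc k) * (suc (suc n) C suc (suc k))
      ≡⟨ cong (suc (suc k) *_) (nCk+nC[k+1]≡[n+1]C[k+1] (suc n) (suc k)) ⟨
    suc (suc k) * (A + B)
      ≡⟨ expand k A B ⟩
    A + suc k * A + suc (suc k) * B
      ≡⟨ cong₂ (λ x y → A + x + y) ([1+k]*[1+n]C[1+k]≡[1+n]*nCk n k)
                                  ([1+k]*[1+n]C[1+k]≡[1+n]*nCk n (suc k)) ⟩
    A + suc n * (n C k) + suc n * (n C suc k)
      ≡⟨ factor A n (n C k) (n C suc k) ⟩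
    A + suc n * (n C k + n C suc k)
      ≡⟨ cong (λ x → A + suc n * x) (nCk+nC[k+1]≡[n+1]C[k+1] n k) ⟩
    A + suc n * A ∎
    where
    open ≡-Reasoning
    A = suc n C suc k
    B = suc n C suc (suc k)
    expand : ∀ k A B → suc (suc k) * (A + B) ≡ A + suc k * A + suc (suc k) * B
    expand = solve-∀
    factor : ∀ A n a b → A + suc n * a + suc n * b ≡ A + suc n * (a + b)
    factor = solve-∀

  [1+c]*[1+c+r]Cr : ∀ c r → suc c * ((suc c + r) C r) ≡ (r + suc c) * ((c + r) C r)
  [1+c]*[1+c+r]Cr c r = begin
    suc c * ((suc c + r) C r)
      ≡⟨ cong (suc c *_) (symmetric (suc c) r) ⟩
    suc c * ((suc c + r) C suc c)
      ≡⟨ [1+k]*[1+n]C[1+k]≡[1+n]*nCk (c + r) c ⟩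
    suc (c + r) * ((c + r) C c)
      ≡⟨ cong₂ _*_ (sym (trans (+-suc r c) (cong suc (+-comm r c)))) (sym (symmetric c r)) ⟩
    (r + suc c) * ((c + r) C r) ∎
    where
    open ≡-Reasoning
    symmetric : ∀ c r → (c + r) C r ≡ (c + r) C c
    symmetric c r = trans (nCk≡nC[n∸k] (m≤n+m r c)) (cong ((c + r) C_) (m+n∸n≡m c r))

module Weights (X : Subset) where

  open import Data.Bool using (true; false; not; if_then_else_)
  open import Data.List using ([]; [_]; _++_; map; length; filterᵇ)
  open import Data.List.Properties using (map-++)
  open import Data.Nat using (zero; suc; _+_; _*_; _!)
  open import Data.Nat.Properties using (+-comm; +-suc; *-identityʳ)
  open import Data.Nat.Combinatorics using (_C_; nCn≡1)
  open import Data.Nat.ListAction using (product)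
  open import Data.Nat.ListAction.Properties using (product-++)
  open import Data.Nat.Tactic.RingSolver using (solve-∀)
  open import Function using (_∘_)
  open import Relation.Binary.PropositionalEquality using (refl; trans; cong; cong₂; module ≡-Reasoning)
  open Lists using (ind)
  open Permutations using (filterᵇ-range-suc; length-filterᵇ-range-suc)
  open Binomial using ([1+c]*[1+c+r]Cr)

  m c : ℕ → ℕ
  m n = length (Xn X n)
  c n = length (Xnc X n)

  Π : ℕ → ℕ → ℕ
  Π n r = product (map (λ x → r + β X n x) (Xn X n))

  weight : ℕ → ℕ → ℕ
  weight n r = c n ! * (((c n + r) C r) * Π n r)

  m-suc : ∀ n → m (suc n) ≡ ind (X (suc n)) + m n
  m-suc n = trans (length-filterᵇ-range-suc X n) (+-comm (m n) _)

  c-suc : ∀ n → c (suc n) ≡ ind (not (X (suc n))) + c n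
  c-suc n = trans (length-filterᵇ-range-suc (not ∘ X) n) (+-comm (c n) _)

  c+m≡n : ∀ n → c n + m n ≡ n
  c+m≡n zero = refl
  c+m≡n (suc n) rewrite c-suc n | m-suc n with X (suc n)
  ... | true = trans (+-suc (c n) (m n)) (cong suc (c+m≡n n))
  ... | false = cong suc (c+m≡n n)

  Π-suc : ∀ n r → Π (suc n) r ≡ Π n r * (if X (suc n) then r + c n else 1)
  Π-suc n r = begin
    product (map f (filterᵇ X (range (suc n))))   ≡⟨ cong (product ∘ map f) (filterᵇ-range-suc X n) ⟩
    product (map f (Xn X n ++ new))               ≡⟨ cong product (map-++ f (Xn X n) new) ⟩
    product (map f (Xn X n) ++ map f new)         ≡⟨ product-++ (map f (Xn X n)) (map f new) ⟩
    Π n r * product (map f new)                   ≡⟨ cong (Π n r *_) last ⟩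
    Π n r * (if X (suc n) then r + c n else 1)    ∎
    where
    open ≡-Reasoning
    f = λ x → r + β X n x
    new = if X (suc n) then [ suc n ] else []
    last : product (map f new) ≡ (if X (suc n) then r + c n else 1)
    last with X (suc n)
    ... | true = *-identityʳ (r + c n)
    ... | false = refl

  weight-suc : ∀ n r → weight (suc n) r ≡ (r + c (suc n)) * weight n r
  weight-suc n r with X (suc n) | c-suc n | Π-suc n r
  ... | true | c≡ | Π≡ = begin
    c (suc n) ! * (((c (suc n) + r) C r) * Π (suc n) r)
      ≡⟨ cong₂ (λ x y → x ! * (((x + r) C r) * y)) c≡ Π≡ ⟩
    c n ! * (((c n + r) C r) * (Π n r * (r + c n)))
      ≡⟨ pull (c n !) ((c n + r) C r) (Π n r) (r + c n) ⟩
    (r + c n) * weight n r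
      ≡⟨ cong (λ x → (r + x) * weight n r) c≡ ⟨
    (r + c (suc n)) * weight n r ∎
    where
    open ≡-Reasoning
    pull : ∀ f b p x → f * (b * (p * x)) ≡ x * (f * (b * p))
    pull = solve-∀
  ... | false | c≡ | Π≡ = begin
    c (suc n) ! * (((c (suc n) + r) C r) * Π (suc n) r)
      ≡⟨ cong₂ (λ x y → x ! * (((x + r) C r) * y)) c≡ (trans Π≡ (*-identityʳ (Π n r))) ⟩
    (suc (c n) * c n !) * (((suc (c n) + r) C r) * Π n r)
      ≡⟨ regroup (suc (c n)) (c n !) ((suc (c n) + r) C r) (Π n r) ⟩
    c n ! * ((suc (c n) * ((suc (c n) + r) C r)) * Π n r)
      ≡⟨ cong (λ x → c n ! * (x * Π n r)) ([1+c]*[1+c+r]Cr (c n) r) ⟩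
    c n ! * (((r + suc (c n)) * ((c n + r) C r)) * Π n r)
      ≡⟨ pull (r + suc (c n)) (c n !) ((c n + r) C r) (Π n r) ⟩
    (r + suc (c n)) * weight n r
      ≡⟨ cong (λ x → (r + x) * weight n r) c≡ ⟨
    (r + c (suc n)) * weight n r ∎
    where
    open ≡-Reasoning
    regroup : ∀ a f b p → (a * f) * (b * p) ≡ f * ((a * b) * p)
    regroup = solve-∀
    pull : ∀ t f b p → f * ((t * b) * p) ≡ t * (f * (b * p))
    pull = solve-∀

  weight-zero : ∀ r → weight zero r ≡ 1
  weight-zero r rewrite nCn≡1 r = refl

module Main where

  open import Data.Nat as ℕ using (zero; suc; _∸_; _<_; _≤_; _!)
  import Data.Nat.Properties as ℕ
  open import Data.Nat.Combinatorics using (_C_)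
  open import Data.Integer using (ℤ; +_; 0ℤ; 1ℤ; -1ℤ; _+_; _-_; _*_; _^_)
  import Data.Integer.Properties as ℤ
  open import Data.Integer.Tactic.RingSolver using (solve-∀)
  open import Data.List using (map; upTo)
  open import Function using (_∘_)
  open import Relation.Binary.PropositionalEquality
    using (refl; sym; trans; cong; cong₂; subst; module ≡-Reasoning)
  open Lists using (ind)
  open DescentRecurrence using (shiftBy; P-suc)
  open Differences
  open Reversal

  module _ {a M N : ℕ} (a+M≡N : a ℕ.+ M ≡ N) {p′ q : ℕ → ℕ} (q0 : VanishesAbove M q)
    (rec : ∀ s → p′ s ≡ (N ∸ s) ℕ.* q s ℕ.+ suc s ℕ.* q (suc s)) where

    open Reversed {a} a+M≡N q0 rec

    rev-eulerStep : ∀ k → + rev M p′ k ≡ eulerStep a (suc N) (λ j → + rev M q j) k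
    rev-eulerStep zero = begin
      + rev M p′ zero                     ≡⟨ cong +_ rev-rec-zero ⟩
      + (a ℕ.* x)                         ≡⟨ ℤ.pos-* a x ⟩
      + a * + x                           ≡⟨ ℤ.+-identityʳ _ ⟨
      + a * + x + 0ℤ                      ≡⟨ cong (λ z → + a * + x + z) (ℤ.*-zeroʳ (+ suc N)) ⟨
      + a * + x + + suc N * 0ℤ            ∎
      where
      open ≡-Reasoning
      x = rev M q zero
    rev-eulerStep (suc k) = begin
      + rev M p′ (suc k)                          ≡⟨ cong +_ (rev-rec-suc k) ⟩
      + (A ℕ.* x ℕ.+ B ℕ.* y)                     ≡⟨ cast ⟩
      + A * + x + + B * + y                       ≡⟨ regroup (+ A) (+ B) (+ x) (+ y) ⟩
      + A * (+ x - + y) + (+ A + + B) * + y       ≡⟨ cong (λ z → + A * (+ x - + y) + z * + y) (ℤ.pos-+ A B) ⟨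
      + A * (+ x - + y) + + (A ℕ.+ B) * + y       ≡⟨ cong (λ z → + A * (+ x - + y) + z) weights ⟨
      + A * (+ x - + y) + + suc N * + y           ∎
      where
      open ≡-Reasoning
      A = suc k ℕ.+ a
      B = M ∸ k
      x = rev M q (suc k)
      y = rev M q k
      cast : + (A ℕ.* x ℕ.+ B ℕ.* y) ≡ + A * + x + + B * + y
      cast = trans (ℤ.pos-+ (A ℕ.* x) (B ℕ.* y)) (cong₂ _+_ (ℤ.pos-* A x) (ℤ.pos-* B y))
      regroup : ∀ A B x y → A * x + B * y ≡ A * (x - y) + (A + B) * y
      regroup = solve-∀
      weights : + suc N * + y ≡ + (A ℕ.+ B) * + y
      weights = trans (sym (ℤ.pos-* (suc N) y)) (trans (cong +_ (rev-weights k)) (ℤ.pos-* (A ℕ.+ B) y))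

  module _ (X : Subset) where

    open Weights X

    P-vanishes : ∀ n → VanishesAbove (m n) (P X n)
    P-vanishes zero {suc s} _ = refl
    P-vanishes (suc n) {s} m<s = begin
      P X (suc n) s
        ≡⟨ P-suc X n s ⟩
      (suc n ∸ s) ℕ.* q s ℕ.+ suc s ℕ.* q (suc s)
        ≡⟨ cong₂ (λ x y → (suc n ∸ s) ℕ.* x ℕ.+ suc s ℕ.* y) (q0 M<s) (q0 (ℕ.m<n⇒m<1+n M<s)) ⟩
      (suc n ∸ s) ℕ.* 0 ℕ.+ suc s ℕ.* 0
        ≡⟨ cong₂ ℕ._+_ (ℕ.*-zeroʳ (suc n ∸ s)) (ℕ.*-zeroʳ (suc s)) ⟩
      0 ∎
      where
      open ≡-Reasoning
      t = ind (X (suc n))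
      q = shiftBy t (P X n)
      q0 = shiftBy-vanishes t (P-vanishes n)
      M<s : t ℕ.+ m n < s
      M<s = subst (_< s) (m-suc n) m<s

    Δweight : ℕ → ℕ → ℤ
    Δweight n = Δ^ (suc n) (λ r → + weight n r)

    Δweight-suc : ∀ n k → Δweight (suc n) k ≡ eulerStep (c (suc n)) (suc (suc n)) (Δweight n) k
    Δweight-suc n k = trans (Δ^-cong (suc (suc n)) weight-suc′ k)
                            (Δ^-product {λ r → + (r ℕ.+ c (suc n))} μ-step (suc n) (λ r → + weight n r) k)
      where
      weight-suc′ : ∀ r → + weight (suc n) r ≡ + (r ℕ.+ c (suc n)) * + weight n r
      weight-suc′ r = trans (cong +_ (weight-suc n r)) (ℤ.pos-* (r ℕ.+ c (suc n)) (weight n r))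
      μ-step : ∀ k → + (suc k ℕ.+ c (suc n)) ≡ + (k ℕ.+ c (suc n)) + 1ℤ
      μ-step k = trans (cong +_ (ℕ.+-comm 1 (k ℕ.+ c (suc n)))) (ℤ.pos-+ (k ℕ.+ c (suc n)) 1)

    Δweight≡rev : ∀ n k → Δweight n k ≡ + rev (m n) (P X n) k
    Δweight≡rev zero zero = cong +_ (weight-zero 0)
    Δweight≡rev zero (suc k) = cong₂ _-_ (cong +_ (weight-zero (suc k))) (cong +_ (weight-zero k))
    Δweight≡rev (suc n) k = begin
      Δweight (suc n) k
        ≡⟨ Δweight-suc n k ⟩
      eulerStep (c (suc n)) (suc (suc n)) (Δweight n) k
        ≡⟨ eulerStep-cong (c (suc n)) (suc (suc n)) (Δweight≡rev n) k ⟩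
      eulerStep (c (suc n)) (suc (suc n)) (λ j → + rev (m n) (P X n) j) k
        ≡⟨ eulerStep-cong (c (suc n)) (suc (suc n)) (cong +_ ∘ rev-shiftBy t (m n) (P X n)) k ⟨
      eulerStep (c (suc n)) (suc (suc n)) (λ j → + rev (t ℕ.+ m n) q j) k
        ≡⟨ rev-eulerStep a+M≡N (shiftBy-vanishes t (P-vanishes n)) (P-suc X n) k ⟨
      + rev (t ℕ.+ m n) (P X (suc n)) k
        ≡⟨ cong (λ M → + rev M (P X (suc n)) k) (m-suc n) ⟨
      + rev (m (suc n)) (P X (suc n)) k ∎
      where
      open ≡-Reasoning
      t = ind (X (suc n))
      q = shiftBy t (P X n)
      a+M≡N : c (suc n) ℕ.+ (t ℕ.+ m n) ≡ suc n
      a+M≡N = trans (cong (c (suc n) ℕ.+_) (sym (m-suc n))) (c+m≡n (suc n))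

    P≡Δweight : ∀ n {s} → s ≤ m n → + P X n s ≡ Δweight n (m n ∸ s)
    P≡Δweight n {s} s≤m = begin
      + P X n s                        ≡⟨ cong +_ (rev-+ k s (P X n)) ⟨
      + rev (k ℕ.+ s) (P X n) k        ≡⟨ cong (λ M → + rev M (P X n) k) (ℕ.m∸n+n≡m s≤m) ⟩
      + rev (m n) (P X n) k            ≡⟨ Δweight≡rev n k ⟨
      Δweight n k                      ∎
      where
      open ≡-Reasoning
      k = m n ∸ s

    RHS≡binomialΔ : ∀ n {s} → s ≤ m n →
                    RHS X n s ≡ binomialΔ (suc n) (λ r → + weight n r) (m n ∸ s)
    RHS≡binomialΔ n {s} s≤m = begin
      + (c n !) * sumℤ (map F (upTo (suc (m n) ∸ s)))
        ≡⟨ cong (λ L → + (c n !) * sumℤ (map F (upTo L))) (ℕ.+-∸-assoc 1 s≤m) ⟩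
      + (c n !) * sumℤ (map F (upTo (suc k)))
        ≡⟨ cong (+ (c n !) *_) (sumℤ-upTo (suc k) F) ⟩
      + (c n !) * Σ< (suc k) F
        ≡⟨ *-Σ< (+ (c n !)) (suc k) F ⟩
      Σ< (suc k) (λ r → + (c n !) * F r)
        ≡⟨ Σ<-cong (suc k) (λ {r} _ → term r) ⟩
      binomialΔ (suc n) (λ r → + weight n r) k ∎
      where
      open ≡-Reasoning
      k = m n ∸ s
      F : ℕ → ℤ
      F r = -1ℤ ^ (k ∸ r) * + ((((c n ℕ.+ r) C r) ℕ.* (suc n C (k ∸ r))) ℕ.* Π n r)
      term : ∀ r → + (c n !) * F r ≡ -1ℤ ^ (k ∸ r) * (+ (suc n C (k ∸ r)) * + weight n r)
      term r = begin
        + (c n !) * (-1ℤ ^ (k ∸ r) * + ((A ℕ.* B) ℕ.* Π n r))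
          ≡⟨ cong (λ z → + (c n !) * (-1ℤ ^ (k ∸ r) * z)) cast-F ⟩
        + (c n !) * (-1ℤ ^ (k ∸ r) * ((+ A * + B) * + Π n r))
          ≡⟨ reorder (+ (c n !)) (+ A) (+ B) (+ Π n r) (-1ℤ ^ (k ∸ r)) ⟩
        -1ℤ ^ (k ∸ r) * (+ B * (+ (c n !) * (+ A * + Π n r)))
          ≡⟨ cong (λ z → -1ℤ ^ (k ∸ r) * (+ B * z)) cast-weight ⟨
        -1ℤ ^ (k ∸ r) * (+ B * + weight n r) ∎
        where
        A = (c n ℕ.+ r) C r
        B = suc n C (k ∸ r)
        cast-F : + ((A ℕ.* B) ℕ.* Π n r) ≡ (+ A * + B) * + Π n r
        cast-F = trans (ℤ.pos-* (A ℕ.* B) (Π n r)) (cong (_* + Π n r) (ℤ.pos-* A B))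
        cast-weight : + weight n r ≡ + (c n !) * (+ A * + Π n r)
        cast-weight = trans (ℤ.pos-* (c n !) (A ℕ.* Π n r)) (cong (+ (c n !) *_) (ℤ.pos-* A (Π n r)))
        reorder : ∀ f a b p x → f * (x * ((a * b) * p)) ≡ x * (b * (f * (a * p)))
        reorder = solve-∀

    RHS-vanishes : ∀ n {s} → m n < s → RHS X n s ≡ 0ℤ
    RHS-vanishes n {s} m<s rewrite ℕ.m≤n⇒m∸n≡0 m<s = ℤ.*-zeroʳ (+ (c n !))

open import Data.Nat using (suc; _∸_; _≥_; _≤?_)
open import Data.Nat.Properties using (≰⇒>)
open import Data.Integer using (+_)
open import Relation.Binary.PropositionalEquality using (cong; sym; trans; module ≡-Reasoning)
open import Relation.Nullary using (yes; no)
open Differences using (binomialΔ; Δ^-binomial)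
open Main

corollary2p7 : (X : Subset) (n s : ℕ) → n ≥ 1 →
    + (P X n s) ≡ RHS X n s
corollary2p7 X n s _ with s ≤? Weights.m X n
... | yes s≤m = begin
  + P X n s                                          ≡⟨ P≡Δweight X n s≤m ⟩
  Δweight X n (m n ∸ s)                              ≡⟨ Δ^-binomial (suc n) _ (m n ∸ s) ⟩
  binomialΔ (suc n) (λ r → + weight n r) (m n ∸ s)   ≡⟨ RHS≡binomialΔ X n s≤m ⟨
  RHS X n s                                          ∎
  where
  open ≡-Reasoning
  open Weights X using (m; weight)
... | no s≰m = trans (cong +_ (P-vanishes X n (≰⇒> s≰m))) (sym (RHS-vanishes X n (≰⇒> s≰m)))
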